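{- Let $s$ and $t$ be positive integers and let $G=(V,E)$ be a connected graph containing no induced $P_t$, no induced $SDK_s$ and no $K_4$. Let $a$, $S_1,\dots,S_{t-1}$ and $B_1,\dots,B_{t-2}$ be produced by the construction described in the context (for any choices made in it), and additionally set $S_0=\emptyset$, $B_0=\{a\}$ and $B_{t-1}=N(S_{t-1})$. For $v\in V$ let $d(v)$ denote the distance in $G$ from $v$ to $a$. Then for every $i=0,1,\dots,t-2$, $$B_{i+1}\setminus(B_i\cup S_i)=\{v\in V: d(v)=i+1\}.$$
   Context: $P_t$ is the path on $t$ vertices; $SDK_s$ is the one-subdivision of $K_{1,s}$, obtained from the star $K_{1,s}$ by replacing each edge $uv$ by a path $u w v$ through a new vertex $w$. For $v\in V$, $N(v)$ is the set of neighbors of $v$, and for $X\subseteq V$, $N(X)=\bigcup_{v\in X}N(v)$. Construction: pick an arbitrary vertex $a\in V$ and set $S_1=\{a\}$. For $i=1,2,\dots,t-2$: let $B_i=N(S_i)$ and $W_i=V\setminus(B_i\cup S_i)$; write $S_i=\{v_1,\dots,v_{|S_i|}\}$ (any order) and for $j=1,\dots,|S_i|$ let $B_i^j=\{v\in B_i\setminus\bigcup_{k=1}^{j-1}B_i^k : v \text{ is adjacent to } v_j\}$; for each $j$ let $X_i^j\subseteq B_i^j$ be an inclusion-minimal set such that every $w\in W_i$ with $N(w)\cap B_i^j\neq\emptyset$ satisfies $N(w)\cap X_i^j\neq\emptyset$; let $X_i=\bigcup_j X_i^j$ and $S_{i+1}=S_i\cup X_i$. -}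

module Defs where

open import Data.Bool using (Bool; true; false; _∧_; _∨_; not)
open import Data.Nat using (ℕ; zero; suc; _+_; _≤_; _≡ᵇ_; _≤ᵇ_)
open import Data.Fin using (Fin; toℕ)
open import Data.Fin.Subset using (Subset; _∈_; _⊆_; _∪_; _∩_; _─_; ∁; ⋃; ⁅_⁆; ⊥)
open import Data.List using (List; []; _∷_)
open import Data.List.Relation.Unary.Unique.Propositional using (Unique)
open import Data.List.Relation.Binary.Pointwise using (Pointwise)
import Data.List.Membership.Propositional as L
open import Data.Vec using (tabulate; lookup)
open import Data.Product using (Σ; ∃; _×_; Σ-syntax; ∃-syntax)
open import Function using (_⇔_; Injective)
open import Relation.Binary.PropositionalEquality using (_≡_; _≢_)

record Graph (n : ℕ) : Set where
  field
    adj    : Fin n → Fin n → Bool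
    sym    : ∀ u v → adj u v ≡ adj v u
    irrefl : ∀ v → adj v v ≡ false
open Graph public

anyᵇ : ∀ {n} → (Fin n → Bool) → Bool
anyᵇ {zero}  f = false
anyᵇ {suc n} f = f Fin.zero ∨ anyᵇ {n} (λ i → f (Fin.suc i))

N : ∀ {n} → Graph n → Subset n → Subset n
N G X = tabulate (λ v → anyᵇ (λ u → lookup X u ∧ adj G u v))

InducedCopy : ∀ {m n} → (Fin m → Fin m → Bool) → Graph n → Set
InducedCopy {m} {n} H G =
  Σ[ f ∈ (Fin m → Fin n) ] (Injective _≡_ _≡_ f × (∀ i j → adj G (f i) (f j) ≡ H i j))

symᵇ : (ℕ → ℕ → Bool) → ∀ {m} → Fin m → Fin m → Bool
symᵇ e i j = e (toℕ i) (toℕ j) ∨ e (toℕ j) (toℕ i)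

Padj : (t : ℕ) → Fin t → Fin t → Bool
Padj t = symᵇ (λ x y → suc x ≡ᵇ y)

Kadj : (m : ℕ) → Fin m → Fin m → Bool
Kadj m i j = not (toℕ i ≡ᵇ toℕ j)

-- SDK_s on vertices 0,…,2s : center 0, subdivision vertices 1..s,
-- leaves s+1..2s ; edges 0 ~ k and k ~ k+s for 1 ≤ k ≤ s.
SDKadj : (s : ℕ) → Fin (suc (s + s)) → Fin (suc (s + s)) → Bool
SDKadj s = symᵇ (λ x y → ((x ≡ᵇ 0) ∧ (1 ≤ᵇ y) ∧ (y ≤ᵇ s))
                       ∨ ((1 ≤ᵇ x) ∧ (x ≤ᵇ s) ∧ (y ≡ᵇ x + s)))

data Walk {n} (G : Graph n) : Fin n → Fin n → ℕ → Set where
  here : ∀ {u} → Walk G u u 0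
  step : ∀ {u v w k} → adj G u v ≡ true → Walk G v w k → Walk G u w (suc k)

Connected : ∀ {n} → Graph n → Set
Connected G = ∀ u v → ∃[ k ] Walk G u v k

Dist : ∀ {n} → Graph n → Fin n → Fin n → ℕ → Set
Dist G a v k = Walk G a v k × (∀ m → Walk G a v m → k ≤ m)

-- The partition B^1, B^2, … of B according to an ordering v_1, v_2, … of S:
-- B^j = { v ∈ B \ (B^1 ∪ … ∪ B^{j-1}) : v adjacent to v_j }
parts : ∀ {n} → Graph n → Subset n → List (Fin n) → List (Subset n)
parts G B []       = []
parts G B (v ∷ vs) = (B ∩ N G ⁅ v ⁆) ∷ parts G (B ─ N G ⁅ v ⁆) vs

Covers : ∀ {n} → Graph n → Subset n → Subset n → Subset n → Set
Covers G W Bj X =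
  ∀ w → w ∈ W → (∃[ b ] (b ∈ Bj × adj G w b ≡ true)) → ∃[ x ] (x ∈ X × adj G w x ≡ true)

MinCover : ∀ {n} → Graph n → Subset n → Subset n → Subset n → Set
MinCover G W Bj X =
  X ⊆ Bj × Covers G W Bj X × (∀ Y → Y ⊆ X → Covers G W Bj Y → X ⊆ Y)

-- S' = S_{i+1} is obtained from S = S_i by one step of the construction,
-- for some ordering of S and some choice of minimal sets X^j
Step : ∀ {n} → Graph n → Subset n → Subset n → Set
Step {n} G S S' =
  Σ[ vs ∈ List (Fin n) ] (Unique vs × (∀ v → (v ∈ S) ⇔ (v L.∈ vs)) ×
    Σ[ Xs ∈ List (Subset n) ]
      (Pointwise (λ Bj X → MinCover G W Bj X) (parts G B vs) Xs × S' ≡ S ∪ ⋃ Xs))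
  where
    B = N G S
    W = ∁ (B ∪ S)

Sₓ : ∀ {n} → (ℕ → Subset n) → ℕ → Subset n
Sₓ S zero    = ⊥
Sₓ S (suc i) = S (suc i)

Bₓ : ∀ {n} → Graph n → Fin n → (ℕ → Subset n) → ℕ → Subset n
Bₓ G a S zero    = ⁅ a ⁆
Bₓ G a S (suc i) = N G (S (suc i))

module Submission where

-- Write Ball j for the set of vertices joined to a by a walk of length at most
-- j, and N[T] = N(T) ∪ T for the closed neighbourhood.  Call T "explored to
-- depth k" when T ⊆ Ball k and Ball (k+1) ⊆ N[T].  The whole proof rests on:
--
--   * S_1 = {a} is explored to depth 0;
--   * one step of the construction turns a set explored to depth k into one
--     explored to depth k+1: the new vertices X ⊆ N(S_i) lie in Ball (k+1),
--     and a vertex w at distance k+2 lies outside N[S_i] next to some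
--     b ∈ N(S_i), so by the covering property of the minimal sets X_i^j it is
--     adjacent to a vertex of X_i ⊆ S_{i+1}.
--
-- Hence B_i ∪ S_i = N[S_i] = Ball i (also for i = 0 by the conventions), and
-- N(S_{i+1}) ∖ Ball i is the sphere of radius i+1.

open import Defs
open import Data.Nat using (ℕ; suc; _+_; _≤_)
open import Data.Fin using (Fin)
open import Data.Fin.Subset using (Subset; _∈_; _∪_; _─_; ⁅_⁆)
open import Function using (_⇔_)
open import Relation.Binary.PropositionalEquality using (_≡_)
open import Relation.Nullary using (¬_)

open import Data.Nat using (zero; z≤n; s≤s; _≤?_)
open import Data.Nat.Properties using (≤-trans; ≤-refl; ≤-antisym; ≤-pred; n≤1+n; ≰⇒>; ≤⇒≯)
open import Data.Bool using (Bool; true; false; _∧_)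
open import Data.Bool.Properties using (∨-zeroʳ)
open import Data.Fin.Subset using (_∉_; ⋃; ⊥; inside; outside)
open import Data.Fin.Subset.Properties
  using (_∈?_; x∈p∪q⁺; x∈p∪q⁻; x∈p∩q⁺; x∈p∩q⁻; x∈⁅x⁆; x∈⁅y⁆⇒x≡y; x∈⁅y⁆⇔x≡y; ∉⊥;
         x∉p⇒x∈∁p; x∈p∧x∉q⇒x∈p─q; p─q⊆p)
open import Data.Vec using (_∷_; lookup; here; there)
open import Data.Vec.Properties using ([]=⇒lookup; lookup⇒[]=; lookup∘tabulate)
open import Data.List using ([]; _∷_)
open import Data.List.Relation.Binary.Pointwise using (Pointwise; []; _∷_)
import Data.List.Membership.Propositional as List
open import Data.List.Relation.Unary.Any using (here; there)
open import Data.Product using (_×_; _,_; proj₁; proj₂; ∃-syntax)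
open import Data.Sum using (_⊎_; inj₁; inj₂)
open import Data.Empty using (⊥-elim)
open import Function using (mk⇔; Equivalence)
open import Relation.Binary.PropositionalEquality using (refl; trans; subst) renaming (sym to ≡-sym)
open import Relation.Nullary using (yes; no)

anyᵇ-witness : ∀ {n} (f : Fin n → Bool) → anyᵇ f ≡ true → ∃[ i ] f i ≡ true
anyᵇ-witness {zero}  f ()
anyᵇ-witness {suc n} f eq with f Fin.zero in f0
... | true  = Fin.zero , f0
... | false with anyᵇ-witness (λ i → f (Fin.suc i)) eq
...   | i , fi = Fin.suc i , fi

anyᵇ-intro : ∀ {n} (f : Fin n → Bool) i → f i ≡ true → anyᵇ f ≡ true
anyᵇ-intro f Fin.zero    fi rewrite fi = refl
anyᵇ-intro f (Fin.suc i) fi rewrite anyᵇ-intro (λ j → f (Fin.suc j)) i fi = ∨-zeroʳ _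

∧-true⁻ : ∀ {x y} → x ∧ y ≡ true → x ≡ true × y ≡ true
∧-true⁻ {true} {true} refl = refl , refl

∧-true⁺ : ∀ {x y} → x ≡ true → y ≡ true → x ∧ y ≡ true
∧-true⁺ refl refl = refl

x∈p─q⇒x∉q : ∀ {n} {x : Fin n} (p q : Subset n) → x ∈ p ─ q → x ∉ q
x∈p─q⇒x∉q (_ ∷ p) (outside ∷ q) (there x∈p─q) (there x∈q) = x∈p─q⇒x∉q p q x∈p─q x∈q
x∈p─q⇒x∉q (_ ∷ p) (inside ∷ q)  (there x∈p─q) (there x∈q) = x∈p─q⇒x∉q p q x∈p─q x∈q

module _ {n : ℕ} (G : Graph n) where

  ∈N⁻ : ∀ {X v} → v ∈ N G X → ∃[ u ] (u ∈ X × adj G u v ≡ true)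
  ∈N⁻ {X} {v} v∈NX
    with anyᵇ-witness (λ u → lookup X u ∧ adj G u v)
           (trans (≡-sym (lookup∘tabulate _ v))
                  ([]=⇒lookup v∈NX))
  ... | u , uv = u , lookup⇒[]= u X (proj₁ (∧-true⁻ uv)) , proj₂ (∧-true⁻ uv)

  ∈N⁺ : ∀ {X u v} → u ∈ X → adj G u v ≡ true → v ∈ N G X
  ∈N⁺ {X} {u} {v} u∈X uv = lookup⇒[]= v _
    (trans (lookup∘tabulate _ v)
           (anyᵇ-intro (λ u → lookup X u ∧ adj G u v) u (∧-true⁺ ([]=⇒lookup u∈X) uv)))

  N[_] : Subset n → Subset n
  N[ T ] = N G T ∪ T

  N[]-mono : ∀ {T T' v} → (∀ {x} → x ∈ T → x ∈ T') → v ∈ N[ T ] → v ∈ N[ T' ]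
  N[]-mono {T} T⊆T' v∈ with x∈p∪q⁻ (N G T) T v∈
  ... | inj₂ v∈T  = x∈p∪q⁺ (inj₂ (T⊆T' v∈T))
  ... | inj₁ v∈NT with ∈N⁻ v∈NT
  ...   | u , u∈T , uv = x∈p∪q⁺ (inj₁ (∈N⁺ (T⊆T' u∈T) uv))

  snoc : ∀ {u v w k} → Walk G u v k → adj G v w ≡ true → Walk G u w (suc k)
  snoc here         vw = step vw here
  snoc (step uv p) vw = step uv (snoc p vw)

  unsnoc : ∀ {u w k} → Walk G u w (suc k) → ∃[ v ] (Walk G u v k × adj G v w ≡ true)
  unsnoc (step uw here) = _ , here , uw
  unsnoc (step uv (step vx p)) with unsnoc (step vx p)
  ... | y , q , yw = y , step uv q , yw

  covers⊆B : ∀ {W B vs Xs} → Pointwise (MinCover G W) (parts G B vs) Xs →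
             ∀ {x} → x ∈ ⋃ Xs → x ∈ B
  covers⊆B {vs = []} [] x∈ = ⊥-elim (∉⊥ x∈)
  covers⊆B {B = B} {v ∷ vs} {X ∷ Xs} (X-min ∷ rest) x∈ with x∈p∪q⁻ X (⋃ Xs) x∈
  ... | inj₁ x∈X  = proj₁ (x∈p∩q⁻ B _ (proj₁ X-min x∈X))
  ... | inj₂ x∈Xs = p─q⊆p B _ (covers⊆B rest x∈Xs)

  -- The
  -- vertex b lies in the block of the first v ∈ vs it is adjacent to.
  covers-dominate : ∀ {W B vs Xs} → Pointwise (MinCover G W) (parts G B vs) Xs →
                    ∀ {b u w} → b ∈ B → u List.∈ vs → adj G u b ≡ true →
                    w ∈ W → adj G w b ≡ true → ∃[ x ] (x ∈ ⋃ Xs × adj G w x ≡ true)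
  covers-dominate {B = B} {v ∷ _} {X ∷ _} (X-min ∷ rest) {b} b∈B u∈vs ub w∈W wb
    with b ∈? N G ⁅ v ⁆
  ... | yes b∈Nv with proj₁ (proj₂ X-min) _ w∈W (b , x∈p∩q⁺ (b∈B , b∈Nv) , wb)
  ...   | x , x∈X , wx = x , x∈p∪q⁺ (inj₁ x∈X) , wx
  covers-dominate (X-min ∷ rest) b∈B (here refl) ub w∈W wb | no b∉Nv =
    ⊥-elim (b∉Nv (∈N⁺ (x∈⁅x⁆ _) ub))
  covers-dominate (X-min ∷ rest) b∈B (there u∈vs) ub w∈W wb | no b∉Nv
    with covers-dominate rest (x∈p∧x∉q⇒x∈p─q b∈B b∉Nv) u∈vs ub w∈W wb
  ... | x , x∈Xs , wx = x , x∈p∪q⁺ (inj₂ x∈Xs) , wx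

  step-dominates : ∀ {T T'} → Step G T T' → ∀ {b w} → b ∈ N G T →
                   w ∉ N[ T ] → adj G b w ≡ true → w ∈ N G T'
  step-dominates {T} (vs , _ , T⇔vs , Xs , X-min , refl) b∈NT w∉ bw
    with ∈N⁻ b∈NT
  ... | u , u∈T , ub
    with covers-dominate X-min b∈NT (Equivalence.to (T⇔vs u) u∈T) ub
           (x∉p⇒x∈∁p w∉) (trans (Graph.sym G _ _) bw)
  ... | x , x∈Xs , wx = ∈N⁺ (x∈p∪q⁺ {p = T} (inj₂ x∈Xs)) (trans (Graph.sym G x _) wx)

  module _ (a : Fin n) where

    Ball : ℕ → Fin n → Set
    Ball j u = ∃[ m ] (m ≤ j × Walk G a u m)

    ball-weaken : ∀ {j u} → Ball j u → Ball (suc j) u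
    ball-weaken (m , m≤j , p) = m , ≤-trans m≤j (n≤1+n _) , p

    ball-N : ∀ {j T v} → (∀ {u} → u ∈ T → Ball j u) → v ∈ N G T → Ball (suc j) v
    ball-N T⊆Ball v∈NT with ∈N⁻ v∈NT
    ... | u , u∈T , uv with T⊆Ball u∈T
    ...   | m , m≤j , p = suc m , s≤s m≤j , snoc p uv

    ball-zero : ∀ {u} → Ball 0 u ⇔ u ≡ a
    ball-zero = mk⇔ (λ { (zero , z≤n , here) → refl }) (λ { refl → 0 , z≤n , here })

    Explored : ℕ → Subset n → Set
    Explored k T = (∀ {u} → u ∈ T → Ball k u) × (∀ {u} → Ball (suc k) u → u ∈ N[ T ])

    explored-ball : ∀ {k T u} → Explored k T → u ∈ N[ T ] ⇔ Ball (suc k) u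
    explored-ball {T = T} (T⊆Ball , Ball⊆N[T]) = mk⇔ to Ball⊆N[T]
      where
      to : ∀ {u} → u ∈ N[ T ] → Ball _ u
      to u∈ with x∈p∪q⁻ (N G T) T u∈
      ... | inj₁ u∈NT = ball-N T⊆Ball u∈NT
      ... | inj₂ u∈T  = ball-weaken (T⊆Ball u∈T)

    explored-start : Explored 0 ⁅ a ⁆
    explored-start = start⊆Ball , Ball⊆N[start]
      where
      start⊆Ball : ∀ {u} → u ∈ ⁅ a ⁆ → Ball 0 u
      start⊆Ball u∈ = Equivalence.from ball-zero (x∈⁅y⁆⇒x≡y a u∈)
      Ball⊆N[start] : ∀ {u} → Ball 1 u → u ∈ N[ ⁅ a ⁆ ]
      Ball⊆N[start] (zero , _ , here) = x∈p∪q⁺ (inj₂ (x∈⁅x⁆ a))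
      Ball⊆N[start] (suc zero , _ , step au here) = x∈p∪q⁺ (inj₁ (∈N⁺ (x∈⁅x⁆ a) au))
      Ball⊆N[start] (suc (suc _) , s≤s () , _)

    explored-step : ∀ {k T T'} → Explored k T → Step G T T' → Explored (suc k) T'
    explored-step {k} {T} (T⊆Ball , Ball⊆N[T]) T→T'@(_ , _ , _ , Xs , X-min , refl) =
      T'⊆Ball , Ball⊆N[T']
      where
      T⊆T' : ∀ {x} → x ∈ T → x ∈ T ∪ ⋃ Xs
      T⊆T' x∈T = x∈p∪q⁺ (inj₁ x∈T)

      T'⊆Ball : ∀ {u} → u ∈ T ∪ ⋃ Xs → Ball (suc k) u
      T'⊆Ball u∈ with x∈p∪q⁻ T (⋃ Xs) u∈
      ... | inj₁ u∈T  = ball-weaken (T⊆Ball u∈T)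
      ... | inj₂ u∈Xs = ball-N T⊆Ball (covers⊆B X-min u∈Xs)

      -- A walk of length ≤ k+2 ends in N[T] or, via its last edge, next to N(T).
      Ball⊆N[T'] : ∀ {u} → Ball (suc (suc k)) u → u ∈ N[ T ∪ ⋃ Xs ]
      Ball⊆N[T'] {u} (m , m≤ , p) with u ∈? N[ T ]
      ... | yes u∈N[T] = N[]-mono T⊆T' u∈N[T]
      ... | no  u∉N[T] with m | m≤ | p
      ...   | zero  | _ | here = ⊥-elim (u∉N[T] (Ball⊆N[T] (0 , z≤n , here)))
      ...   | suc m | s≤s m≤ | p with unsnoc p
      ...     | b , q , bu with x∈p∪q⁻ (N G T) T (Ball⊆N[T] (m , m≤ , q))
      ...       | inj₂ b∈T  = ⊥-elim (u∉N[T] (x∈p∪q⁺ (inj₁ (∈N⁺ b∈T bu))))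
      ...       | inj₁ b∈NT = x∈p∪q⁺ (inj₁ (step-dominates T→T' b∈NT u∉N[T] bu))

    sphere : ∀ {i v} → (Ball (suc i) v × ¬ Ball i v) ⇔ Dist G a v (suc i)
    sphere {i} {v} = mk⇔ to from
      where
      outside-ball : ¬ Ball i v → ∀ m → Walk G a v m → suc i ≤ m
      outside-ball v∉ m p with suc i ≤? m
      ... | yes i<m = i<m
      ... | no  i≮m = ⊥-elim (v∉ (m , ≤-pred (≰⇒> i≮m) , p))
      to : Ball (suc i) v × ¬ Ball i v → Dist G a v (suc i)
      to ((m , m≤ , p) , v∉) =
        subst (Walk G a v) (≤-antisym m≤ (outside-ball v∉ m p)) p , outside-ball v∉
      from : Dist G a v (suc i) → Ball (suc i) v × ¬ Ball i v
      from (p , minimal) = (suc i , ≤-refl , p) , λ (m , m≤ , q) → ≤⇒≯ m≤ (minimal m q)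

    frontier : ∀ {i T P} → Explored i T → (∀ {u} → u ∈ P ⇔ Ball i u) →
               ∀ v → v ∈ N G T ─ P ⇔ Dist G a v (suc i)
    frontier {i} {T} {P} explored@(T⊆Ball , _) P⇔Ball v =
      mk⇔ (λ v∈ → Equivalence.to sphere (to v∈)) (λ d → from (Equivalence.from sphere d))
      where
      to : v ∈ N G T ─ P → Ball (suc i) v × ¬ Ball i v
      to v∈ = ball-N T⊆Ball (p─q⊆p (N G T) P v∈) ,
              λ v∈Ball → x∈p─q⇒x∉q (N G T) P v∈ (Equivalence.from P⇔Ball v∈Ball)
      from : Ball (suc i) v × ¬ Ball i v → v ∈ N G T ─ P
      from (v∈Ball , v∉Ball)
        with x∈p∪q⁻ (N G T) T (Equivalence.from (explored-ball explored) v∈Ball)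
      ... | inj₂ v∈T  = ⊥-elim (v∉Ball (T⊆Ball v∈T))
      ... | inj₁ v∈NT = x∈p∧x∉q⇒x∈p─q v∈NT (λ v∈P → v∉Ball (Equivalence.to P⇔Ball v∈P))

lemma3p2 : ∀ {n} (s t : ℕ) → 1 ≤ s → 1 ≤ t → (G : Graph n) → Connected G →
    ¬ InducedCopy (Padj t) G → ¬ InducedCopy (SDKadj s) G → ¬ InducedCopy (Kadj 4) G →
    (a : Fin n) (S : ℕ → Subset n) → S 1 ≡ ⁅ a ⁆ →
    (∀ i → 1 ≤ i → i + 2 ≤ t → Step G (S i) (S (suc i))) →
    ∀ i → i + 2 ≤ t → ∀ v →
    (v ∈ (Bₓ G a S (suc i) ─ (Bₓ G a S i ∪ Sₓ S i))) ⇔ Dist G a v (suc i)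
lemma3p2 s t _ _ G _ _ _ _ a S S₁≡a steps i i+2≤t =
  frontier G a (explored i i+2≤t) (previous-layer i i+2≤t)
  where
  explored : ∀ k → k + 2 ≤ t → Explored G a k (S (suc k))
  explored zero    _   = subst (Explored G a 0) (≡-sym S₁≡a)
                               (explored-start G a)
  explored (suc k) k+3≤t =
    explored-step G a (explored k (≤-trans (n≤1+n _) k+3≤t)) (steps (suc k) (s≤s z≤n) k+3≤t)

  previous-layer : ∀ i → i + 2 ≤ t → ∀ {u} → u ∈ Bₓ G a S i ∪ Sₓ S i ⇔ Ball G a i u
  previous-layer zero    _ {u} = mk⇔
    (λ u∈ → case₀ (x∈p∪q⁻ ⁅ a ⁆ ⊥ u∈))
    (λ u∈Ball → x∈p∪q⁺ (inj₁ (Equivalence.from x∈⁅y⁆⇔x≡y (Equivalence.to (ball-zero G a) u∈Ball))))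
    where
    case₀ : u ∈ ⁅ a ⁆ ⊎ u ∈ ⊥ → Ball G a 0 u
    case₀ (inj₁ u∈a) = Equivalence.from (ball-zero G a) (x∈⁅y⁆⇒x≡y a u∈a)
    case₀ (inj₂ u∈⊥) = ⊥-elim (∉⊥ u∈⊥)
  previous-layer (suc k) k+3≤t = explored-ball G a (explored k (≤-trans (n≤1+n _) k+3≤t))
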